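{- If $p:\{0,1\}^n\times\{0,1\}^n\to\mathbb{R}$ is an even polynomial with $k$ monomials, then $m(p)=k$.
   Context: Variables are $x_1,\ldots,x_n,y_1,\ldots,y_n$. A monomial (with nonzero real coefficient) of a multilinear polynomial is even if, for every $i$, it contains $x_i$ iff it contains $y_i$; a multilinear polynomial is even if each of its (nonzero) monomials is even. The decomposition number $m(p)$ is the minimal $m$ such that there exist functions $a_1,\ldots,a_m$ and $b_1,\ldots,b_m$ from $\{0,1\}^n$ to $\mathbb{R}$ with $p(x,y)=\sum_{i=1}^m a_i(x)b_i(y)$ for all $x,y\in\{0,1\}^n$. -}

module Defs where

open import Level using (Level; _⊔_) renaming (suc to lsuc)
open import Algebra.Bundles using (CommutativeRing)
open import Data.Bool using (Bool; true; false)
open import Data.Nat using (ℕ; zero; suc; _≤_)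
open import Data.Fin using (Fin)
import Data.Fin as Fin
open import Data.Vec using (Vec; []; _∷_)
open import Data.List using (List; map; foldr; length)
open import Data.List.Relation.Unary.All using (All)
open import Data.List.Relation.Unary.Unique.Propositional using (Unique)
open import Data.Product using (Σ; _×_; _,_; proj₁; proj₂)
open import Relation.Nullary using (¬_)
open import Relation.Binary.PropositionalEquality using (_≡_)

record Field (c ℓ : Level) : Set (lsuc (c ⊔ ℓ)) where
  field
    commutativeRing : CommutativeRing c ℓ
  open CommutativeRing commutativeRing public
  field
    1≉0     : ¬ (1# ≈ 0#)
    inverse : ∀ x → ¬ (x ≈ 0#) → Σ Carrier λ y → x * y ≈ 1#

module FieldDefs {c ℓ : Level} (F : Field c ℓ) where
  open Field F

  Point : ℕ → Set
  Point n = Vec Bool n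

  -- A subset of {1..n} (characteristic vector): which variables occur.
  VarSet : ℕ → Set
  VarSet n = Vec Bool n

  -- A multilinear monomial in x_1..x_n, y_1..y_n: the set of x-variables
  -- and the set of y-variables it contains.
  Monomial : ℕ → Set
  Monomial n = VarSet n × VarSet n

  ⟦_⟧ : Bool → Carrier
  ⟦ true ⟧  = 1#
  ⟦ false ⟧ = 0#

  prodVars : ∀ {n} → VarSet n → Point n → Carrier
  prodVars []          []      = 1#
  prodVars (true ∷ S)  (b ∷ z) = ⟦ b ⟧ * prodVars S z
  prodVars (false ∷ S) (b ∷ z) = prodVars S z

  evalMonomial : ∀ {n} → Monomial n → Point n → Point n → Carrier
  evalMonomial (S , T) x y = prodVars S x * prodVars T y

  record MLPoly (n : ℕ) : Set (c ⊔ ℓ) where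
    field
      terms    : List (Monomial n × Carrier)
      distinct : Unique (map proj₁ terms)
      nonzero  : All (λ t → ¬ (proj₂ t ≈ 0#)) terms
  open MLPoly public

  eval : ∀ {n} → MLPoly n → Point n → Point n → Carrier
  eval p x y = foldr (λ t acc → proj₂ t * evalMonomial (proj₁ t) x y + acc) 0# (terms p)

  numMonomials : ∀ {n} → MLPoly n → ℕ
  numMonomials p = length (terms p)

  EvenMonomial : ∀ {n} → Monomial n → Set
  EvenMonomial (S , T) = S ≡ T

  IsEven : ∀ {n} → MLPoly n → Set c
  IsEven p = All (λ t → EvenMonomial (proj₁ t)) (terms p)

  sumFin : (m : ℕ) → (Fin m → Carrier) → Carrier
  sumFin zero    f = 0#
  sumFin (suc m) f = f Fin.zero + sumFin m (λ i → f (Fin.suc i))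

  Decomposes : ∀ {n} → MLPoly n → ℕ → Set (c ⊔ ℓ)
  Decomposes {n} p m =
    Σ (Fin m → Point n → Carrier) λ a →
    Σ (Fin m → Point n → Carrier) λ b →
    ∀ x y → eval p x y ≈ sumFin m (λ i → a i x * b i y)

  DecompositionNumberIs : ∀ {n} → MLPoly n → ℕ → Set (c ⊔ ℓ)
  DecompositionNumberIs p k = Decomposes p k × (∀ m → Decomposes p m → k ≤ m)

-- Put p = Σ c_S x^S y^S.  The k rank-one terms (c_S x^S) · y^S show m(p) ≤ k.  Conversely,
-- pick S of minimal size and evaluate at its indicator point: every other monomial x^T y^T has
-- |T| ≥ |S| and T ≠ S, hence T ⊈ S, and vanishes there.  So p(x,S) = c_S x^S, p(S,y) = c_S y^S,
-- and p − p(·,S) c_S⁻¹ p(S,·) is the even polynomial p with the monomial S removed.  Subtracting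
-- such a rank-one term from a sum of m products with a nonzero pivot leaves a sum of m − 1
-- products (Gaussian elimination), so induction on k gives k ≤ m.
module Submission where

open import Defs
open import Level using (Level; _⊔_)
open import Data.Nat using (ℕ; zero; suc; _≤_; _<_; z≤n; s≤s; s<s⁻¹; _≤?_)
open import Data.Nat.Properties using (≤-trans; ≰⇒≥; <⇒≱; ≮⇒≥)
open import Data.Fin using (Fin; punchIn)
import Data.Fin as Fin
open import Data.Fin.Subset using (Subset; inside; outside; _⊆_; ∣_∣)
open import Data.Fin.Subset.Properties using (drop-∷-⊆; in⊆in; out⊆; _⊆?_; p⊆q⇒∣p∣≤∣q∣)
open import Data.Vec using ([]; _∷_; here)
open import Data.Vec.Functional using () renaming (_∷_ to _∷ᶠ_)
open import Data.List using (List; []; _∷_; length; foldr; map)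
open import Data.List.Properties using (foldr-map)
open import Data.List.Relation.Unary.All using (All; []; _∷_)
import Data.List.Relation.Unary.All as All
open import Data.List.Relation.Unary.All.Properties using (map⁻)
open import Data.List.Relation.Unary.AllPairs using (_∷_)
open import Data.List.Relation.Binary.Permutation.Propositional
  using (_↭_; ↭-refl; ↭-prep; ↭-swap; ↭-trans; ↭-sym; ↭⇒↭ₛ; ↭⇒↭ₛ′)
open import Data.List.Relation.Binary.Permutation.Propositional.Properties
  using (All-resp-↭; ↭-length; map⁺)
import Data.List.Relation.Binary.Permutation.Setoid.Properties as SetoidPermutation
open import Data.Product using (Σ-syntax; ∃; _×_; _,_; proj₁; proj₂)
open import Function using (_∘_)
open import Data.Empty using (⊥-elim)
open import Relation.Nullary using (¬_; yes; no)
open import Relation.Nullary.Negation using (contradiction; ¬¬-map)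
open import Relation.Binary.PropositionalEquality as ≡ using (_≡_; _≢_; cong; ≢-sym)

¬¬-Π-Fin : ∀ {p} m {P : Fin m → Set p} → (∀ i → ¬ ¬ P i) → ¬ ¬ (∀ i → P i)
¬¬-Π-Fin zero    _   ¬∀P = ¬∀P λ ()
¬¬-Π-Fin (suc m) ¬¬P ¬∀P = ¬¬P Fin.zero λ P₀ → ¬¬-Π-Fin m (¬¬P ∘ Fin.suc) λ Pₛ →
  ¬∀P λ { Fin.zero → P₀ ; (Fin.suc i) → Pₛ i }

extract-minimum : ∀ {a} {A : Set a} (w : A → ℕ) (x : A) (xs : List A) →
  Σ[ u ∈ A ] Σ[ rest ∈ List A ] (x ∷ xs ↭ u ∷ rest) × All (λ v → w u ≤ w v) rest
extract-minimum w x [] = x , [] , ↭-refl , []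
extract-minimum w x (y ∷ ys) with extract-minimum w y ys
... | u , rest , y∷ys↭u∷rest , u≤rest with w x ≤? w u
...   | yes x≤u = x , y ∷ ys , ↭-refl ,
          All-resp-↭ (↭-sym y∷ys↭u∷rest) (x≤u ∷ All.map (≤-trans x≤u) u≤rest)
...   | no  x≰u = u , x ∷ rest , ↭-trans (↭-prep x y∷ys↭u∷rest) (↭-swap x u ↭-refl) ,
          ≰⇒≥ x≰u ∷ u≤rest

p⊆q∧∣q∣≤∣p∣⇒p≡q : ∀ {n} {p q : Subset n} → p ⊆ q → ∣ q ∣ ≤ ∣ p ∣ → p ≡ q
p⊆q∧∣q∣≤∣p∣⇒p≡q {p = []}          {[]}          _   _  = ≡.refl
p⊆q∧∣q∣≤∣p∣⇒p≡q {p = outside ∷ p} {outside ∷ q} p⊆q le =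
  cong (outside ∷_) (p⊆q∧∣q∣≤∣p∣⇒p≡q (drop-∷-⊆ p⊆q) le)
p⊆q∧∣q∣≤∣p∣⇒p≡q {p = outside ∷ p} {inside  ∷ q} p⊆q le =
  contradiction le (<⇒≱ (s≤s (p⊆q⇒∣p∣≤∣q∣ (drop-∷-⊆ p⊆q))))
p⊆q∧∣q∣≤∣p∣⇒p≡q {p = inside  ∷ p} {outside ∷ q} p⊆q _  = contradiction (p⊆q here) λ ()
p⊆q∧∣q∣≤∣p∣⇒p≡q {p = inside  ∷ p} {inside  ∷ q} p⊆q (s≤s le) =
  cong (inside ∷_) (p⊆q∧∣q∣≤∣p∣⇒p≡q (drop-∷-⊆ p⊆q) le)

module _ {c ℓ : Level} (F : Field c ℓ) where
  open Field F
  open FieldDefs F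
  open import Algebra.Properties.Ring ring using (-1*x≈-x; [y-z]x≈yx-zx; x[y-z]≈xy-xz)
  open import Algebra.Properties.AbelianGroup +-abelianGroup using (xyx⁻¹≈y)
  open import Algebra.Properties.Group +-group using (x≈y⇒x∙y⁻¹≈ε; ε⁻¹≈ε)
  open import Algebra.Properties.Semiring.Sum semiring
    using ( sum; sum-syntax; sum-cong-≋; sum-replicate-zero; sum-remove; ∑-distrib-+
          ; *-distribˡ-sum; *-distribʳ-sum)
  open import Algebra.Solver.Ring.NaturalCoefficients.Default commutativeSemiring
  open import Relation.Binary.Reasoning.Setoid setoid

  Decomposable : ∀ {X Y : Set} → (X → Y → Carrier) → ℕ → Set (c ⊔ ℓ)
  Decomposable {X} {Y} f m =
    Σ[ a ∈ (Fin m → X → Carrier) ] Σ[ b ∈ (Fin m → Y → Carrier) ]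
      (∀ x y → f x y ≈ ∑[ i < m ] (a i x * b i y))

  decomposable-resp-≈ : ∀ {X Y : Set} {m} {f g : X → Y → Carrier} →
    (∀ x y → f x y ≈ g x y) → Decomposable f m → Decomposable g m
  decomposable-resp-≈ f≈g (a , b , f≈) = a , b , λ x y → trans (sym (f≈g x y)) (f≈ x y)

  sumFin≡sum : ∀ m (f : Fin m → Carrier) → sumFin m f ≡ sum f
  sumFin≡sum zero    f = ≡.refl
  sumFin≡sum (suc m) f = cong (f Fin.zero +_) (sumFin≡sum m (f ∘ Fin.suc))

  decomposes⇒decomposable : ∀ {n m} {p : MLPoly n} → Decomposes p m → Decomposable (eval p) m
  decomposes⇒decomposable {m = m} (a , b , p≈) =
    a , b , λ x y → trans (p≈ x y) (reflexive (sumFin≡sum m (λ i → a i x * b i y)))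

  decomposable⇒decomposes : ∀ {n m} {p : MLPoly n} → Decomposable (eval p) m → Decomposes p m
  decomposable⇒decomposes {m = m} (a , b , p≈) =
    a , b , λ x y → trans (p≈ x y) (reflexive (≡.sym (sumFin≡sum m (λ i → a i x * b i y))))

  ∑-distrib-- : ∀ {m} (u v : Fin m → Carrier) → ∑[ i < m ] (u i - v i) ≈ sum u - sum v
  ∑-distrib-- u v = begin
    ∑[ i < _ ] (u i - v i)          ≈⟨ ∑-distrib-+ u (-_ ∘ v) ⟩
    sum u + ∑[ i < _ ] (- v i)      ≈⟨ +-congˡ (sum-cong-≋ (λ i → -1*x≈-x (v i))) ⟨
    sum u + ∑[ i < _ ] (- 1# * v i) ≈⟨ +-congˡ (*-distribˡ-sum (- 1#) v) ⟨
    sum u + - 1# * sum v            ≈⟨ +-congˡ (-1*x≈-x (sum v)) ⟩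
    sum u - sum v                   ∎

  invertible⇒≉0 : ∀ {x d} → x * d ≈ 1# → ¬ (x ≈ 0#)
  invertible⇒≉0 {x} {d} xd≈1 x≈0 = 1≉0 (begin
    1#     ≈⟨ xd≈1 ⟨
    x * d  ≈⟨ *-congʳ x≈0 ⟩
    0# * d ≈⟨ zeroˡ d ⟩
    0#     ∎)

  module _ {X Y : Set} {m : ℕ} {f : X → Y → Carrier}
           (a : Fin m → X → Carrier) (b : Fin m → Y → Carrier)
           (f≈ : ∀ x y → f x y ≈ ∑[ i < m ] (a i x * b i y)) where

    row-operation : ∀ (k : X → Carrier) x₀ x y →
      f x y - k x * f x₀ y ≈ ∑[ i < m ] ((a i x - k x * a i x₀) * b i y)
    row-operation k x₀ x y = sym (begin
      ∑[ i < m ] ((a i x - k x * a i x₀) * b i y)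
        ≈⟨ sum-cong-≋ term ⟩
      ∑[ i < m ] (a i x * b i y - k x * (a i x₀ * b i y))
        ≈⟨ ∑-distrib-- (λ i → a i x * b i y) (λ i → k x * (a i x₀ * b i y)) ⟩
      ∑[ i < m ] (a i x * b i y) - ∑[ i < m ] (k x * (a i x₀ * b i y))
        ≈⟨ +-cong (f≈ x y) (-‿cong (trans (*-congˡ (f≈ x₀ y))
                                          (*-distribˡ-sum (k x) (λ i → a i x₀ * b i y)))) ⟨
      f x y - k x * f x₀ y ∎)
      where
      term : ∀ i → (a i x - k x * a i x₀) * b i y ≈ a i x * b i y - k x * (a i x₀ * b i y)
      term i = trans ([y-z]x≈yx-zx (b i y) (a i x) (k x * a i x₀))
                     (+-congˡ (-‿cong (*-assoc (k x) (a i x₀) (b i y))))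

    column-operation : ∀ (k : Y → Carrier) y₀ x y →
      f x y - f x y₀ * k y ≈ ∑[ i < m ] (a i x * (b i y - b i y₀ * k y))
    column-operation k y₀ x y = sym (begin
      ∑[ i < m ] (a i x * (b i y - b i y₀ * k y))
        ≈⟨ sum-cong-≋ term ⟩
      ∑[ i < m ] (a i x * b i y - (a i x * b i y₀) * k y)
        ≈⟨ ∑-distrib-- (λ i → a i x * b i y) (λ i → (a i x * b i y₀) * k y) ⟩
      ∑[ i < m ] (a i x * b i y) - ∑[ i < m ] ((a i x * b i y₀) * k y)
        ≈⟨ +-cong (f≈ x y) (-‿cong (trans (*-congʳ (f≈ x y₀))
                                          (*-distribʳ-sum (k y) (λ i → a i x * b i y₀)))) ⟨
      f x y - f x y₀ * k y ∎)
      where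
      term : ∀ i → a i x * (b i y - b i y₀ * k y) ≈ a i x * b i y - (a i x * b i y₀) * k y
      term i = trans (x[y-z]≈xy-xz (a i x) (b i y) (b i y₀ * k y))
                     (+-congˡ (-‿cong (sym (*-assoc (a i x) (b i y₀) (k y)))))

    pivot-exists : ∀ {x₀ y₀} → ¬ (f x₀ y₀ ≈ 0#) → ¬ ¬ (∃ λ j → ¬ (b j y₀ ≈ 0#))
    pivot-exists {x₀} {y₀} f≉0 ∄j = ¬¬-Π-Fin m (λ j bj≉0 → ∄j (j , bj≉0)) λ b≈0 → f≉0 (begin
      f x₀ y₀                       ≈⟨ f≈ x₀ y₀ ⟩
      ∑[ i < m ] (a i x₀ * b i y₀)  ≈⟨ sum-cong-≋ (λ i → trans (*-congˡ (b≈0 i)) (zeroʳ _)) ⟩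
      ∑[ i < m ] 0#                 ≈⟨ sum-replicate-zero m ⟩
      0#                            ∎)

  drop-vanishing-term : ∀ {X Y : Set} {m} {f : X → Y → Carrier}
    (a : Fin (suc m) → X → Carrier) (b : Fin (suc m) → Y → Carrier) →
    (∀ x y → f x y ≈ ∑[ i < suc m ] (a i x * b i y)) →
    ∀ j → (∀ y → b j y ≈ 0#) → Decomposable f m
  drop-vanishing-term {f = f} a b f≈ j bj≈0 = a ∘ punchIn j , b ∘ punchIn j , λ x y → begin
    f x y                                                    ≈⟨ f≈ x y ⟩
    ∑[ i < _ ] (a i x * b i y)                               ≈⟨ sum-remove (λ i → a i x * b i y) ⟩
    a j x * b j y + ∑[ i < _ ] (a (punchIn j i) x * b (punchIn j i) y)
      ≈⟨ +-congʳ (trans (*-congˡ (bj≈0 y)) (zeroʳ (a j x))) ⟩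
    0# + ∑[ i < _ ] (a (punchIn j i) x * b (punchIn j i) y)  ≈⟨ +-identityˡ _ ⟩
    ∑[ i < _ ] (a (punchIn j i) x * b (punchIn j i) y)       ∎

  -- Equality in F need not be decidable, so an index j with b j y₀ ≉ 0 is only found under
  -- double negation; this suffices because the lower bound it serves is a negated statement.
  decomposable-eliminate : ∀ {X Y : Set} {m} {f : X → Y → Carrier} {x₀ y₀ d} →
    Decomposable f (suc m) → f x₀ y₀ * d ≈ 1# →
    ¬ ¬ Decomposable (λ x y → f x y - (f x y₀ * d) * f x₀ y) m
  decomposable-eliminate {X} {Y} {m} {f} {x₀} {y₀} {d} (a , b , f≈) fd≈1 =
    ¬¬-map eliminate-pivot (pivot-exists a b f≈ (invertible⇒≉0 fd≈1))
    where
    g : X → Y → Carrier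
    g x y = f x y - (f x y₀ * d) * f x₀ y

    a′ : Fin (suc m) → X → Carrier
    a′ i x = a i x - (f x y₀ * d) * a i x₀

    g≈ : ∀ x y → g x y ≈ ∑[ i < suc m ] (a′ i x * b i y)
    g≈ = row-operation a b f≈ (λ x → f x y₀ * d) x₀

    g-vanishes : ∀ x → g x y₀ ≈ 0#
    g-vanishes x = x≈y⇒x∙y⁻¹≈ε (begin
      f x y₀                       ≈⟨ *-identityʳ _ ⟨
      f x y₀ * 1#                  ≈⟨ *-congˡ fd≈1 ⟨
      f x y₀ * (f x₀ y₀ * d)       ≈⟨ solve 3 (λ u w e → u :* (w :* e) := (u :* e) :* w)
                                              refl (f x y₀) (f x₀ y₀) d ⟩
      (f x y₀ * d) * f x₀ y₀       ∎)

    eliminate-pivot : ∃ (λ j → ¬ (b j y₀ ≈ 0#)) → Decomposable g m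
    eliminate-pivot (j , bj≉0) with inverse (b j y₀) bj≉0
    ... | e , be≈1 = drop-vanishing-term a′ b′ g≈′ j b′-vanishes
      where
      b′ : Fin (suc m) → Y → Carrier
      b′ i y = b i y - b i y₀ * (e * b j y)

      g≈′ : ∀ x y → g x y ≈ ∑[ i < suc m ] (a′ i x * b′ i y)
      g≈′ x y = begin
        g x y                               ≈⟨ +-identityʳ _ ⟨
        g x y + 0#                          ≈⟨ +-congˡ ε⁻¹≈ε ⟨
        g x y - 0#
          ≈⟨ +-congˡ (-‿cong (trans (*-congʳ (g-vanishes x)) (zeroˡ _))) ⟨
        g x y - g x y₀ * (e * b j y)
          ≈⟨ column-operation a′ b g≈ (λ y → e * b j y) y₀ x y ⟩
        ∑[ i < suc m ] (a′ i x * b′ i y)    ∎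

      b′-vanishes : ∀ y → b′ j y ≈ 0#
      b′-vanishes y = x≈y⇒x∙y⁻¹≈ε (begin
        b j y                 ≈⟨ *-identityˡ _ ⟨
        1# * b j y            ≈⟨ *-congʳ be≈1 ⟨
        (b j y₀ * e) * b j y  ≈⟨ *-assoc _ _ _ ⟩
        b j y₀ * (e * b j y)  ∎)

  schur-complement : ∀ {X Y : Set} {f g : X → Y → Carrier} {u : X → Carrier} {v : Y → Carrier}
    {x₀ y₀ c d} → u x₀ ≈ 1# → v y₀ ≈ 1# → (∀ x → g x y₀ ≈ 0#) → (∀ y → g x₀ y ≈ 0#) →
    c * d ≈ 1# → (∀ x y → f x y ≈ c * (u x * v y) + g x y) →
    f x₀ y₀ * d ≈ 1# × (∀ x y → g x y ≈ f x y - (f x y₀ * d) * f x₀ y)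
  schur-complement {f = f} {g} {u} {v} {x₀} {y₀} {c} {d} u₀≈1 v₀≈1 g-row g-col cd≈1 f≈ =
    pivot-invertible , complement
    where
    f-row : ∀ x → f x y₀ ≈ c * u x
    f-row x = begin
      f x y₀                       ≈⟨ f≈ x y₀ ⟩
      c * (u x * v y₀) + g x y₀
        ≈⟨ +-cong (*-congˡ (trans (*-congˡ v₀≈1) (*-identityʳ _))) (g-row x) ⟩
      c * u x + 0#                 ≈⟨ +-identityʳ _ ⟩
      c * u x                      ∎

    f-col : ∀ y → f x₀ y ≈ c * v y
    f-col y = begin
      f x₀ y                       ≈⟨ f≈ x₀ y ⟩
      c * (u x₀ * v y) + g x₀ y
        ≈⟨ +-cong (*-congˡ (trans (*-congʳ u₀≈1) (*-identityˡ _))) (g-col y) ⟩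
      c * v y + 0#                 ≈⟨ +-identityʳ _ ⟩
      c * v y                      ∎

    pivot-invertible : f x₀ y₀ * d ≈ 1#
    pivot-invertible = begin
      f x₀ y₀ * d    ≈⟨ *-congʳ (trans (f-row x₀) (trans (*-congˡ u₀≈1) (*-identityʳ c))) ⟩
      c * d          ≈⟨ cd≈1 ⟩
      1#             ∎

    complement : ∀ x y → g x y ≈ f x y - (f x y₀ * d) * f x₀ y
    complement x y = sym (begin
      f x y - (f x y₀ * d) * f x₀ y
        ≈⟨ +-cong (f≈ x y) (-‿cong (*-cong (*-congʳ (f-row x)) (f-col y))) ⟩
      (c * (u x * v y) + g x y) - ((c * u x) * d) * (c * v y)
        ≈⟨ +-congˡ (-‿cong (solve 4 (λ c d ux vy → ((c :* ux) :* d) :* (c :* vy)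
                                                  := (c :* (ux :* vy)) :* (c :* d))
                                    refl c d (u x) (v y))) ⟩
      (c * (u x * v y) + g x y) - (c * (u x * v y)) * (c * d)
        ≈⟨ +-congˡ (-‿cong (trans (*-congˡ cd≈1) (*-identityʳ _))) ⟩
      (c * (u x * v y) + g x y) - c * (u x * v y)
        ≈⟨ xyx⁻¹≈y (c * (u x * v y)) (g x y) ⟩
      g x y ∎)

  Term : ℕ → Set c
  Term n = Monomial n × Carrier

  evalTerms : ∀ {n} → List (Term n) → Point n → Point n → Carrier
  evalTerms ts x y = foldr (λ t acc → proj₂ t * evalMonomial (proj₁ t) x y + acc) 0# ts

  decomposable-evalTerms : ∀ {n} (ts : List (Term n)) → Decomposable (evalTerms ts) (length ts)
  decomposable-evalTerms []                   = (λ ()) , (λ ()) , λ _ _ → refl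
  decomposable-evalTerms (((S , T) , k) ∷ ts) with decomposable-evalTerms ts
  ... | a , b , ts≈ =
    (λ x → k * prodVars S x) ∷ᶠ a , prodVars T ∷ᶠ b , λ x y → +-cong (sym (*-assoc k _ _)) (ts≈ x y)

  evalTerms-resp-↭ : ∀ {n} {ts us : List (Term n)} → ts ↭ us →
    ∀ x y → evalTerms ts x y ≈ evalTerms us x y
  evalTerms-resp-↭ {ts = ts} {us} ts↭us x y = begin
    evalTerms ts x y            ≡⟨ foldr-map _+_ value 0# ts ⟨
    foldr _+_ 0# (map value ts) ≈⟨ SetoidPermutation.foldr-commMonoid setoid +-isCommutativeMonoid
                                     (↭⇒↭ₛ′ isEquivalence (map⁺ value ts↭us)) ⟩
    foldr _+_ 0# (map value us) ≡⟨ foldr-map _+_ value 0# us ⟩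
    evalTerms us x y            ∎
    where
    value : Term _ → Carrier
    value t = proj₂ t * evalMonomial (proj₁ t) x y

  evalTerms-sym : ∀ {n} {ts : List (Term n)} → All (EvenMonomial ∘ proj₁) ts →
    ∀ x y → evalTerms ts x y ≈ evalTerms ts y x
  evalTerms-sym []            x y = refl
  evalTerms-sym (≡.refl ∷ ev) x y = +-cong (*-congˡ (*-comm _ _)) (evalTerms-sym ev x y)

  prodVars-diagonal : ∀ {n} (S : VarSet n) → prodVars S S ≈ 1#
  prodVars-diagonal []            = refl
  prodVars-diagonal (inside  ∷ S) = trans (*-identityˡ _) (prodVars-diagonal S)
  prodVars-diagonal (outside ∷ S) = prodVars-diagonal S

  prodVars-⊈ : ∀ {n} {T S : VarSet n} → ¬ (T ⊆ S) → prodVars T S ≈ 0#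
  prodVars-⊈ {T = []}          {[]}          T⊈S = ⊥-elim (T⊈S λ ())
  prodVars-⊈ {T = inside  ∷ T} {inside  ∷ S} T⊈S =
    trans (*-identityˡ _) (prodVars-⊈ (T⊈S ∘ in⊆in))
  prodVars-⊈ {T = inside  ∷ T} {outside ∷ S} T⊈S = zeroˡ _
  prodVars-⊈ {T = outside ∷ T} {_       ∷ S} T⊈S = prodVars-⊈ (T⊈S ∘ out⊆)

  prodVars-vanishes : ∀ {n} {T S : VarSet n} → ∣ S ∣ ≤ ∣ T ∣ → T ≢ S → prodVars T S ≈ 0#
  prodVars-vanishes {T = T} {S} ∣S∣≤∣T∣ T≢S with T ⊆? S
  ... | yes T⊆S = contradiction (p⊆q∧∣q∣≤∣p∣⇒p≡q T⊆S ∣S∣≤∣T∣) T≢S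
  ... | no  T⊈S = prodVars-⊈ T⊈S

  evalTerms-vanishes : ∀ {n} {S : VarSet n} (ts : List (Term n)) →
    All (EvenMonomial ∘ proj₁) ts → All (λ t → (S , S) ≢ proj₁ t) ts →
    All (λ t → ∣ S ∣ ≤ ∣ proj₁ (proj₁ t) ∣) ts → ∀ x → evalTerms ts x S ≈ 0#
  evalTerms-vanishes []                   []            []         []            x = refl
  evalTerms-vanishes {S = S} (((T , _) , k) ∷ ts) (≡.refl ∷ ev) (S≢T ∷ ne) (∣S∣≤∣T∣ ∷ le) x = begin
    k * (prodVars T x * prodVars T S) + evalTerms ts x S
      ≈⟨ +-cong monomial-vanishes (evalTerms-vanishes ts ev ne le x) ⟩
    0# + 0#  ≈⟨ +-identityʳ 0# ⟩
    0#       ∎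
    where
    T≢S : T ≢ S
    T≢S T≡S = S≢T (cong (λ U → U , U) (≡.sym T≡S))

    monomial-vanishes : k * (prodVars T x * prodVars T S) ≈ 0#
    monomial-vanishes =
      trans (*-congˡ (trans (*-congˡ (prodVars-vanishes ∣S∣≤∣T∣ T≢S)) (zeroʳ _))) (zeroʳ k)

  record PivotReduction {n} (p : MLPoly n) : Set (c ⊔ ℓ) where
    field
      pivot                : Point n
      pivot⁻¹              : Carrier
      pivot-invertible     : eval p pivot pivot * pivot⁻¹ ≈ 1#
      reduced              : MLPoly n
      reduced-even         : IsEven reduced
      numMonomials-reduced : numMonomials p ≡ suc (numMonomials reduced)
      eval-reduced         : ∀ x y →
        eval reduced x y ≈ eval p x y - (eval p x pivot * pivot⁻¹) * eval p pivot y

  pivotReduction : ∀ {n} (p : MLPoly n) → IsEven p → 0 < numMonomials p → PivotReduction p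
  pivotReduction {n} record { terms = t ∷ ts ; distinct = distinct ; nonzero = nonzero } ev _
    with extract-minimum (λ t → ∣ proj₁ (proj₁ t) ∣) t ts
  ... | ((S , _) , k) , rest , t∷ts↭ , minimal
    with All-resp-↭ t∷ts↭ ev | All-resp-↭ t∷ts↭ nonzero
       | SetoidPermutation.AllPairs-resp-↭ (≡.setoid (Monomial n)) ≢-sym (≡.resp₂ _≢_)
           (↭⇒↭ₛ (map⁺ proj₁ t∷ts↭)) distinct
  ... | ≡.refl ∷ rest-even | k≉0 ∷ rest-nonzero | S∉rest ∷ rest-distinct
    with inverse k k≉0
  ... | k⁻¹ , kk⁻¹≈1
    with schur-complement (prodVars-diagonal S) (prodVars-diagonal S)
                          rest-vanishesʳ rest-vanishesˡ kk⁻¹≈1 split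
    where
    rest-vanishesʳ : ∀ x → evalTerms rest x S ≈ 0#
    rest-vanishesʳ = evalTerms-vanishes rest rest-even (map⁻ S∉rest) minimal

    rest-vanishesˡ : ∀ y → evalTerms rest S y ≈ 0#
    rest-vanishesˡ y = trans (evalTerms-sym rest-even S y) (rest-vanishesʳ y)

    split : ∀ x y →
      evalTerms (t ∷ ts) x y ≈ k * (prodVars S x * prodVars S y) + evalTerms rest x y
    split = evalTerms-resp-↭ t∷ts↭
  ... | pivot-invertible , complement = record
    { pivot                = S
    ; pivot⁻¹              = k⁻¹
    ; pivot-invertible     = pivot-invertible
    ; reduced              = record { terms = rest ; distinct = rest-distinct ; nonzero = rest-nonzero }
    ; reduced-even         = rest-even
    ; numMonomials-reduced = ↭-length t∷ts↭
    ; eval-reduced         = complement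
    }

  decomposable⇒≮numMonomials : ∀ {n} m (p : MLPoly n) → IsEven p →
    Decomposable (eval p) m → ¬ (m < numMonomials p)
  decomposable⇒≮numMonomials zero p ev (_ , _ , p≈0) 0<k =
    invertible⇒≉0 pivot-invertible (p≈0 pivot pivot)
    where open PivotReduction (pivotReduction p ev 0<k)
  decomposable⇒≮numMonomials (suc m) p ev p-decomposable m<k =
    decomposable-eliminate p-decomposable pivot-invertible λ reduced-decomposable →
      decomposable⇒≮numMonomials m reduced reduced-even
        (decomposable-resp-≈ (λ x y → sym (eval-reduced x y)) reduced-decomposable)
        (s<s⁻¹ (≡.subst (suc m <_) numMonomials-reduced m<k))
    where open PivotReduction (pivotReduction p ev (≤-trans (s≤s z≤n) m<k))

lemma2 : ∀ {c ℓ : Level} (F : Field c ℓ) (n : ℕ) (p : FieldDefs.MLPoly F n)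
         → FieldDefs.IsEven F p
         → FieldDefs.DecompositionNumberIs F p (FieldDefs.numMonomials F p)
lemma2 F n p ev =
  decomposable⇒decomposes F {p = p} (decomposable-evalTerms F (terms p)) ,
  λ m p-decomposes →
    ≮⇒≥ (decomposable⇒≮numMonomials F m p ev (decomposes⇒decomposable F {p = p} p-decomposes))
  where open FieldDefs F
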